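{- Let $f_2,g_2:\omega\to\omega$ be strictly increasing functions with $f_2(i)>g_2(i)$ for all $i<\omega$ and $\sum_{i<\omega}\frac{g_2(i)}{f_2(i)}<\infty$, and put $m^*_i=g_2(i)$, $m^{**}_i=f_2(i)$. Let $\lambda$ be a cardinal. Suppose that for every $Y\subseteq\prod_{i<\omega}m^{**}_i$ with $|Y|\leq\lambda$ there is $\nu\in\prod_{i<\omega}[m^{**}_i]^{m^*_i}$ such that for every $\eta\in Y$ there are infinitely many $i<\omega$ with $\eta(i)\in\nu(i)$. Then $\mathrm{non}(\mathcal N)>\lambda$.
   Context: Each natural number $m$ is identified with $\{0,\dots,m-1\}$, and $[m]^{k}$ denotes the set of $k$-element subsets of $m$. $\mathcal N$ is the ideal of Lebesgue-null subsets of the Cantor space $2^\omega$, and $\mathrm{non}(\mathcal N)$ is the minimal cardinality of a non-null subset of $2^\omega$. -}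

module Defs where

open import Data.Nat using (ℕ; zero; suc; _<_; _≤_; _^_)
open import Data.Integer using (+_)
open import Data.Rational using (ℚ; 0ℚ; _/_) renaming (_+_ to _+ℚ_; _≤_ to _≤ℚ_)
open import Data.Bool using (Bool)
open import Data.List using (List; []; _∷_; length)
open import Data.Fin using (Fin)
open import Data.Fin.Subset using (Subset; _∈_; ∣_∣)
open import Data.Product using (Σ; ∃; _×_; _,_)
open import Relation.Binary.PropositionalEquality using (_≡_)

Cantor : Set
Cantor = ℕ → Bool

-- a / b as a rational, with the convention a / 0 = 0 (only used with b ≥ 1)
frac : ℕ → ℕ → ℚ
frac a zero    = 0ℚ
frac a (suc b) = (+ a) / suc b

partialSum : (ℕ → ℚ) → ℕ → ℚ
partialSum s zero    = 0ℚ
partialSum s (suc N) = partialSum s N +ℚ s N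

-- Σ_{i<ω} s i < ∞  (nonnegative terms): partial sums are bounded
Summable : (ℕ → ℚ) → Set
Summable s = Σ ℚ λ B → ∀ N → partialSum s N ≤ℚ B

StrictlyIncreasing : (ℕ → ℕ) → Set
StrictlyIncreasing f = ∀ i j → i < j → f i < f j

InfinitelyMany : (ℕ → Set) → Set
InfinitelyMany P = ∀ n → Σ ℕ λ i → n ≤ i × P i

_≺_ : List Bool → Cantor → Set
[] ≺ x = Data.Unit.⊤ where import Data.Unit
(b ∷ s) ≺ x = (x zero ≡ b) × (s ≺ (λ n → x (suc n)))

-- Lebesgue measure of the basic clopen set [s] = 2^{-|s|}
weight : List Bool → ℚ
weight s = frac 1 (2 ^ length s)

Null : (Cantor → Set) → Set
Null A = ∀ k → Σ (ℕ → List Bool) λ c →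
           (∀ N → partialSum (λ n → weight (c n)) N ≤ℚ frac 1 (2 ^ k))
         × (∀ x → A x → Σ ℕ λ n → c n ≺ x)

_∈[_]^_ : ∀ {m} → Subset m → ℕ → ℕ → Set
_∈[_]^_ {m} p _ k = ∣ p ∣ ≡ k

module Submission where

-- Cut ω into consecutive blocks of lengths L i with 2^(L i) ≤ f₂ i ≤ 2^(L i + 1), so that the
-- bits of a point on block i encode a number below f₂ i.  Feeding the codes of the points Z a to
-- the hypothesis yields sets ν i of size g₂ i that every Z a meets infinitely often, and
-- Σ |ν i| / 2^(L i) ≤ 2 Σ g₂ i / f₂ i < ∞.  It remains to show, Borel–Cantelli style, that the
-- points whose codes fall into ν i for infinitely many i form a null set.  As no tail of the
-- series is computably small, we cover instead the points with at least m such hits: by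
-- Markov's inequality at most a fraction K/m of the strings of each length are heavy (have m
-- hits), and the minimal heavy strings form an antichain whose measure telescopes to the same
-- bound.  Enumerating all strings level by level and replacing the non-minimal ones by long
-- padded extensions of negligible measure turns this antichain into a cover indexed by ℕ.

open import Defs
open import Data.Nat using (ℕ; _<_)
open import Data.Fin using (Fin)
open import Data.Fin.Subset using (Subset; _∈_)
open import Data.Product using (Σ; _×_)
open import Relation.Binary.PropositionalEquality using (_≡_)

open import Algebra.Bundles using (CommutativeMonoid)
open import Algebra.Properties.CommutativeSemigroup using (interchange)
open import Data.Bool using (Bool; true; false; if_then_else_)
open import Data.Fin using (toℕ; fromℕ<)
open import Data.Fin.Properties using (toℕ-fromℕ<)
open import Data.Fin.Subset using (∣_∣)
open import Data.Integer as ℤ using (+≤+)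
import Data.Integer.Properties as ℤ
open import Data.Integer.Tactic.RingSolver using (solve-∀)
open import Data.List using (List; []; _∷_; _++_; length; replicate; applyUpTo)
open import Data.List.Properties using (length-++; length-replicate; length-applyUpTo)
open import Data.Nat using (zero; suc; pred; _+_; _*_; _∸_; _^_; _≤_; z≤n; s≤s; _<?_; _≤?_)
open import Data.Nat.Properties
open import Data.Nat.Solver using (module +-*-Solver)
open +-*-Solver using (solve; _:+_; _:*_; _:=_; con)
open import Data.Product using (_,_; proj₁; proj₂)
open import Data.Rational as ℚ using (ℚ; 0ℚ; mkℚ; ↥_; toℚᵘ) renaming (_+_ to _+ℚ_; _≤_ to _≤ℚ_)
import Data.Rational.Properties as ℚ
open import Data.Rational.Unnormalised as ℚᵘ using (mkℚᵘ; *≤*; *≡*)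
import Data.Rational.Unnormalised.Properties as ℚᵘ
open import Data.Unit using (tt)
open import Data.Vec using ([]; _∷_; here; there)
open import Function using (_∘_)
open import Relation.Nullary using (Dec; yes; no; ¬_; _×-dec_; ¬?)
open import Relation.Nullary.Negation using (contradiction)
open import Relation.Binary.PropositionalEquality
  using (refl; sym; trans; cong; cong₂; subst; subst₂; module ≡-Reasoning)

-- Finite sums

sum< : ℕ → (ℕ → ℕ) → ℕ
sum< zero    h = 0
sum< (suc n) h = h 0 + sum< n (h ∘ suc)

sum<-cong : ∀ n {h h′ : ℕ → ℕ} → (∀ i → i < n → h i ≡ h′ i) → sum< n h ≡ sum< n h′
sum<-cong zero    eq = refl
sum<-cong (suc n) eq = cong₂ _+_ (eq 0 (s≤s z≤n)) (sum<-cong n (λ i i<n → eq (suc i) (s≤s i<n)))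

sum<-mono-≤ : ∀ n {h h′ : ℕ → ℕ} → (∀ i → i < n → h i ≤ h′ i) → sum< n h ≤ sum< n h′
sum<-mono-≤ zero    le = z≤n
sum<-mono-≤ (suc n) le = +-mono-≤ (le 0 (s≤s z≤n)) (sum<-mono-≤ n (λ i i<n → le (suc i) (s≤s i<n)))

sum<-zero : ∀ n → sum< n (λ _ → 0) ≡ 0
sum<-zero zero    = refl
sum<-zero (suc n) = sum<-zero n

sum<-+ : ∀ a b h → sum< (a + b) h ≡ sum< a h + sum< b (h ∘ (a +_))
sum<-+ zero    b h = refl
sum<-+ (suc a) b h = trans (cong (h 0 +_) (sum<-+ a b (h ∘ suc))) (sym (+-assoc (h 0) _ _))

sum<-suc : ∀ n h → sum< (suc n) h ≡ sum< n h + h n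
sum<-suc n h = begin
  sum< (suc n) h                  ≡⟨ cong (λ k → sum< k h) (+-comm 1 n) ⟩
  sum< (n + 1) h                  ≡⟨ sum<-+ n 1 h ⟩
  sum< n h + (h (n + 0) + 0)      ≡⟨ cong (sum< n h +_) (trans (+-identityʳ _) (cong h (+-identityʳ n))) ⟩
  sum< n h + h n                  ∎
  where open ≡-Reasoning

≤-sum< : ∀ n h {i} → i < n → h i ≤ sum< n h
≤-sum< (suc n) h {zero}  _         = m≤m+n (h 0) _
≤-sum< (suc n) h {suc i} (s≤s i<n) = ≤-trans (≤-sum< n (h ∘ suc) i<n) (m≤n+m _ (h 0))

sum<-monoˡ-≤ : ∀ h {a b} → a ≤ b → sum< a h ≤ sum< b h
sum<-monoˡ-≤ h {a} a≤b with m≤n⇒∃[o]m+o≡n a≤b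
... | o , refl = subst (sum< a h ≤_) (sym (sum<-+ a o h)) (m≤m+n _ _)

sum<-+-≤ : ∀ h a {j o} → j < o → sum< a h + h (a + j) ≤ sum< (a + o) h
sum<-+-≤ h a {j} {o} j<o = subst (sum< a h + h (a + j) ≤_) (sym (sum<-+ a o h))
  (+-monoʳ-≤ (sum< a h) (≤-sum< o (h ∘ (a +_)) j<o))

sumStrings : ℕ → (List Bool → ℕ) → ℕ
sumStrings zero    h = h []
sumStrings (suc ℓ) h = sumStrings ℓ (h ∘ (false ∷_)) + sumStrings ℓ (h ∘ (true ∷_))

sumStrings-mono-≤ : ∀ ℓ {h h′ : List Bool → ℕ} → (∀ s → length s ≡ ℓ → h s ≤ h′ s) →
                    sumStrings ℓ h ≤ sumStrings ℓ h′
sumStrings-mono-≤ zero    le = le [] refl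
sumStrings-mono-≤ (suc ℓ) le =
  +-mono-≤ (sumStrings-mono-≤ ℓ (λ s eq → le (false ∷ s) (cong suc eq)))
           (sumStrings-mono-≤ ℓ (λ s eq → le (true ∷ s) (cong suc eq)))

sumStrings-cong : ∀ ℓ {h h′ : List Bool → ℕ} → (∀ s → length s ≡ ℓ → h s ≡ h′ s) →
                  sumStrings ℓ h ≡ sumStrings ℓ h′
sumStrings-cong ℓ eq = ≤-antisym (sumStrings-mono-≤ ℓ (λ s e → ≤-reflexive (eq s e)))
                                 (sumStrings-mono-≤ ℓ (λ s e → ≤-reflexive (sym (eq s e))))

sumStrings-distrib-+ : ∀ ℓ h h′ →
                       sumStrings ℓ (λ s → h s + h′ s) ≡ sumStrings ℓ h + sumStrings ℓ h′
sumStrings-distrib-+ zero    h h′ = refl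
sumStrings-distrib-+ (suc ℓ) h h′ =
  trans (cong₂ _+_ (sumStrings-distrib-+ ℓ (h ∘ (false ∷_)) (h′ ∘ (false ∷_)))
                   (sumStrings-distrib-+ ℓ (h ∘ (true ∷_)) (h′ ∘ (true ∷_))))
        (interchange +-commutativeSemigroup
          (sumStrings ℓ (h ∘ (false ∷_))) (sumStrings ℓ (h′ ∘ (false ∷_)))
          (sumStrings ℓ (h ∘ (true ∷_)))  (sumStrings ℓ (h′ ∘ (true ∷_))))

sumStrings-*ˡ : ∀ ℓ c h → sumStrings ℓ (λ s → c * h s) ≡ c * sumStrings ℓ h
sumStrings-*ˡ zero    c h = refl
sumStrings-*ˡ (suc ℓ) c h =
  trans (cong₂ _+_ (sumStrings-*ˡ ℓ c (h ∘ (false ∷_))) (sumStrings-*ˡ ℓ c (h ∘ (true ∷_))))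
        (sym (*-distribˡ-+ c _ _))

2^suc≡2^+2^ : ∀ ℓ → 2 ^ suc ℓ ≡ 2 ^ ℓ + 2 ^ ℓ
2^suc≡2^+2^ ℓ = cong (2 ^ ℓ +_) (+-identityʳ (2 ^ ℓ))

sumStrings-const : ∀ ℓ c → sumStrings ℓ (λ _ → c) ≡ 2 ^ ℓ * c
sumStrings-const zero    c = sym (+-identityʳ c)
sumStrings-const (suc ℓ) c = begin
  sumStrings ℓ (λ _ → c) + sumStrings ℓ (λ _ → c)
    ≡⟨ cong₂ _+_ (sumStrings-const ℓ c) (sumStrings-const ℓ c) ⟩
  2 ^ ℓ * c + 2 ^ ℓ * c ≡⟨ sym (*-distribʳ-+ c (2 ^ ℓ) (2 ^ ℓ)) ⟩
  (2 ^ ℓ + 2 ^ ℓ) * c   ≡⟨ cong (_* c) (sym (2^suc≡2^+2^ ℓ)) ⟩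
  2 ^ suc ℓ * c         ∎
  where open ≡-Reasoning

sumStrings-++ : ∀ a b h → sumStrings (a + b) h ≡ sumStrings a (λ u → sumStrings b (λ v → h (u ++ v)))
sumStrings-++ zero    b h = refl
sumStrings-++ (suc a) b h =
  cong₂ _+_ (sumStrings-++ a b (h ∘ (false ∷_))) (sumStrings-++ a b (h ∘ (true ∷_)))

sumStrings-snoc : ∀ ℓ h →
                  sumStrings (suc ℓ) h ≡ sumStrings ℓ (λ u → h (u ++ false ∷ []) + h (u ++ true ∷ []))
sumStrings-snoc ℓ h = trans (cong (λ n → sumStrings n h) (+-comm 1 ℓ)) (sumStrings-++ ℓ 1 h)

sumStrings-sum< : ∀ ℓ n (q : ℕ → List Bool → ℕ) →
                  sumStrings ℓ (λ s → sum< n (λ i → q i s)) ≡ sum< n (λ i → sumStrings ℓ (q i))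
sumStrings-sum< ℓ zero    q = trans (sumStrings-const ℓ 0) (*-zeroʳ (2 ^ ℓ))
sumStrings-sum< ℓ (suc n) q =
  trans (sumStrings-distrib-+ ℓ (q 0) _) (cong (sumStrings ℓ (q 0) +_) (sumStrings-sum< ℓ n (q ∘ suc)))

when : ∀ {A : Set} → Dec A → ℕ → ℕ
when (yes _) n = n
when (no  _) n = 0

𝟙 : ∀ {A : Set} → Dec A → ℕ
𝟙 a? = when a? 1

when-yes : ∀ {A : Set} (a? : Dec A) → ∀ {n} → A → when a? n ≡ n
when-yes (yes _) a = refl
when-yes (no ¬a) a = contradiction a ¬a

when-no : ∀ {A : Set} (a? : Dec A) → ∀ {n} → ¬ A → when a? n ≡ 0
when-no (yes a) ¬a = contradiction a ¬a
when-no (no  _) ¬a = refl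

when-mono : ∀ {A B : Set} → (A → B) → (a? : Dec A) (b? : Dec B) → ∀ {n} → when a? n ≤ when b? n
when-mono A→B (yes a) (yes _) = ≤-refl
when-mono A→B (yes a) (no ¬b) = contradiction (A→B a) ¬b
when-mono A→B (no  _) b?      = z≤n

when-congʳ : ∀ {A : Set} (a? : Dec A) → ∀ {n n′} → (A → n ≡ n′) → when a? n ≡ when a? n′
when-congʳ (yes a) eq = eq a
when-congʳ (no  _) eq = refl

m*𝟙≤ : ∀ {m n} (a? : Dec (m ≤ n)) → m * 𝟙 a? ≤ n
m*𝟙≤ {m}     (yes m≤n) = ≤-trans (≤-reflexive (*-identityʳ m)) m≤n
m*𝟙≤ {m} {n} (no _)    = subst (_≤ n) (sym (*-zeroʳ m)) z≤n

first-crossing : ∀ (h : ℕ → ℕ) {m} → h 0 < m → ∀ ℓ → m ≤ h ℓ →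
                 Σ ℕ λ ℓ′ → h ℓ′ < m × m ≤ h (suc ℓ′)
first-crossing h h0<m zero    m≤h0 = contradiction m≤h0 (<⇒≱ h0<m)
first-crossing h {m} h0<m (suc ℓ) m≤h with m ≤? h ℓ
... | yes m≤hℓ = first-crossing h h0<m ℓ m≤hℓ
... | no  m≰hℓ = ℓ , ≰⇒> m≰hℓ , m≤h

-- Binary strings and the numbers they encode

pad : List Bool → Cantor
pad []      _       = false
pad (b ∷ s) zero    = b
pad (b ∷ s) (suc q) = pad s q

pad-++ˡ : ∀ u r {q} → q < length u → pad (u ++ r) q ≡ pad u q
pad-++ˡ (b ∷ u) r {zero}  _         = refl
pad-++ˡ (b ∷ u) r {suc q} (s≤s q<u) = pad-++ˡ u r q<u

pad-++ʳ : ∀ u r q → pad (u ++ r) (length u + q) ≡ pad r q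
pad-++ʳ []      r q = refl
pad-++ʳ (b ∷ u) r q = pad-++ʳ u r q

pad-applyUpTo : ∀ x n {q} → q < n → pad (applyUpTo x n) q ≡ x q
pad-applyUpTo x (suc n) {zero}  _         = refl
pad-applyUpTo x (suc n) {suc q} (s≤s q<n) = pad-applyUpTo (x ∘ suc) n q<n

applyUpTo≺ : ∀ x n → applyUpTo x n ≺ x
applyUpTo≺ x zero    = tt
applyUpTo≺ x (suc n) = refl , applyUpTo≺ (x ∘ suc) n

bit : Bool → ℕ → ℕ
bit false e = 0
bit true  e = 2 ^ e

-- The first bit is the most significant one, as in `binary` below.
value : ℕ → Cantor → ℕ
value zero    x = 0
value (suc L) x = bit (x 0) L + value L (x ∘ suc)

value<2^ : ∀ L x → value L x < 2 ^ L
value<2^ zero    x = s≤s z≤n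
value<2^ (suc L) x with x 0
... | false = ≤-trans (value<2^ L (x ∘ suc)) (m≤m+n (2 ^ L) (2 ^ L + 0))
... | true  = begin-strict
  2 ^ L + value L (x ∘ suc) <⟨ +-monoʳ-< (2 ^ L) (value<2^ L (x ∘ suc)) ⟩
  2 ^ L + 2 ^ L             ≡⟨ sym (2^suc≡2^+2^ L) ⟩
  2 ^ suc L                 ∎
  where open ≤-Reasoning

value-cong : ∀ L {x y : Cantor} → (∀ q → q < L → x q ≡ y q) → value L x ≡ value L y
value-cong zero    eq = refl
value-cong (suc L) eq = cong₂ _+_ (cong (λ b → bit b L) (eq 0 (s≤s z≤n)))
                                  (value-cong L (λ q q<L → eq (suc q) (s≤s q<L)))

binary : ℕ → ℕ → List Bool
binary zero    t = []
binary (suc ℓ) t with t <? 2 ^ ℓ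
... | yes _ = false ∷ binary ℓ t
... | no  _ = true ∷ binary ℓ (t ∸ 2 ^ ℓ)

length-binary : ∀ ℓ t → length (binary ℓ t) ≡ ℓ
length-binary zero    t = refl
length-binary (suc ℓ) t with t <? 2 ^ ℓ
... | yes _ = cong suc (length-binary ℓ t)
... | no  _ = cong suc (length-binary ℓ (t ∸ 2 ^ ℓ))

binary-bit : ∀ ℓ b {t} → t < 2 ^ ℓ → binary (suc ℓ) (bit b ℓ + t) ≡ b ∷ binary ℓ t
binary-bit ℓ false {t} t<2^ℓ with t <? 2 ^ ℓ
... | yes _     = refl
... | no  t≮2^ℓ = contradiction t<2^ℓ t≮2^ℓ
binary-bit ℓ true  {t} t<2^ℓ with 2 ^ ℓ + t <? 2 ^ ℓ
... | yes 2^ℓ+t<2^ℓ = contradiction 2^ℓ+t<2^ℓ (m+n≮m (2 ^ ℓ) t)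
... | no  _         = cong (λ n → true ∷ binary ℓ n) (m+n∸m≡n (2 ^ ℓ) t)

binary-value : ∀ s → binary (length s) (value (length s) (pad s)) ≡ s
binary-value []      = refl
binary-value (b ∷ s) =
  trans (binary-bit (length s) b (value<2^ (length s) (pad s))) (cong (b ∷_) (binary-value s))

sumStrings-value : ∀ L (φ : ℕ → ℕ) → sumStrings L (φ ∘ value L ∘ pad) ≡ sum< (2 ^ L) φ
sumStrings-value zero    φ = sym (+-identityʳ (φ 0))
sumStrings-value (suc L) φ = begin
  sumStrings L (φ ∘ value L ∘ pad) + sumStrings L ((φ ∘ (2 ^ L +_)) ∘ value L ∘ pad)
    ≡⟨ cong₂ _+_ (sumStrings-value L φ) (sumStrings-value L (φ ∘ (2 ^ L +_))) ⟩
  sum< (2 ^ L) φ + sum< (2 ^ L) (φ ∘ (2 ^ L +_)) ≡⟨ sym (sum<-+ (2 ^ L) (2 ^ L) φ) ⟩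
  sum< (2 ^ L + 2 ^ L) φ                         ≡⟨ cong (λ n → sum< n φ) (sym (2^suc≡2^+2^ L)) ⟩
  sum< (2 ^ suc L) φ                             ∎
  where open ≡-Reasoning

sum<-binary : ∀ ℓ h → sum< (2 ^ ℓ) (h ∘ binary ℓ) ≡ sumStrings ℓ h
sum<-binary ℓ h = trans (sym (sumStrings-value ℓ (h ∘ binary ℓ))) (sumStrings-cong ℓ (λ s eq →
  cong h (subst (λ n → binary n (value n (pad s)) ≡ s) eq (binary-value s))))

sumStrings-block : ∀ p L R (φ : ℕ → ℕ) →
  sumStrings (p + (L + R)) (λ s → φ (value L (λ q → pad s (p + q)))) ≡ 2 ^ p * (2 ^ R * sum< (2 ^ L) φ)
sumStrings-block p L R φ = begin
  sumStrings (p + (L + R)) (λ s → φ (value L (λ q → pad s (p + q))))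
    ≡⟨ sumStrings-++ p (L + R) _ ⟩
  sumStrings p (λ u → sumStrings (L + R) (λ r → φ (value L (λ q → pad (u ++ r) (p + q)))))
    ≡⟨ sumStrings-cong p (λ u eq → sumStrings-cong (L + R) (λ r _ → cong φ (value-cong L (λ q _ →
         trans (cong (λ n → pad (u ++ r) (n + q)) (sym eq)) (pad-++ʳ u r q))))) ⟩
  sumStrings p (λ _ → sumStrings (L + R) (λ r → φ (value L (pad r))))
    ≡⟨ sumStrings-cong p (λ _ _ → sumStrings-++ L R _) ⟩
  sumStrings p (λ _ → sumStrings L (λ v → sumStrings R (λ w → φ (value L (pad (v ++ w))))))
    ≡⟨ sumStrings-cong p (λ _ _ → sumStrings-cong L (λ v eq → sumStrings-cong R (λ w _ →
         cong φ (value-cong L (λ q q<L → pad-++ˡ v w (subst (q <_) (sym eq) q<L)))))) ⟩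
  sumStrings p (λ _ → sumStrings L (λ v → sumStrings R (λ _ → φ (value L (pad v)))))
    ≡⟨ sumStrings-cong p (λ _ _ → trans (sumStrings-cong L (λ v _ → sumStrings-const R _))
                                        (sumStrings-*ˡ L (2 ^ R) _)) ⟩
  sumStrings p (λ _ → 2 ^ R * sumStrings L (φ ∘ value L ∘ pad))
    ≡⟨ sumStrings-const p _ ⟩
  2 ^ p * (2 ^ R * sumStrings L (φ ∘ value L ∘ pad))
    ≡⟨ cong (λ n → 2 ^ p * (2 ^ R * n)) (sumStrings-value L φ) ⟩
  2 ^ p * (2 ^ R * sum< (2 ^ L) φ) ∎
  where open ≡-Reasoning

indicator : ∀ {n} → Subset n → ℕ → ℕ
indicator []      _       = 0
indicator (b ∷ p) zero    = if b then 1 else 0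
indicator (b ∷ p) (suc t) = indicator p t

indicator-∈ : ∀ {n} {p : Subset n} {x} → x ∈ p → indicator p (toℕ x) ≡ 1
indicator-∈ here        = refl
indicator-∈ (there x∈p) = indicator-∈ x∈p

sum<-indicator : ∀ {n} M (p : Subset n) → sum< M (indicator p) ≤ ∣ p ∣
sum<-indicator zero    p           = z≤n
sum<-indicator (suc M) []          = ≤-reflexive (sum<-zero M)
sum<-indicator (suc M) (false ∷ p) = sum<-indicator M p
sum<-indicator (suc M) (true  ∷ p) = s≤s (sum<-indicator M p)

sumStrings-indicator : ∀ {n} p L R (ν : Subset n) →
  sumStrings (p + (L + R)) (λ s → indicator ν (value L (λ q → pad s (p + q)))) * 2 ^ L
    ≤ ∣ ν ∣ * 2 ^ (p + (L + R))
sumStrings-indicator p L R ν = begin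
  sumStrings (p + (L + R)) (λ s → indicator ν (value L (λ q → pad s (p + q)))) * 2 ^ L
    ≡⟨ cong (_* 2 ^ L) (sumStrings-block p L R (indicator ν)) ⟩
  2 ^ p * (2 ^ R * sum< (2 ^ L) (indicator ν)) * 2 ^ L
    ≤⟨ *-monoˡ-≤ (2 ^ L) (*-monoʳ-≤ (2 ^ p) (*-monoʳ-≤ (2 ^ R) (sum<-indicator (2 ^ L) ν))) ⟩
  2 ^ p * (2 ^ R * ∣ ν ∣) * 2 ^ L
    ≡⟨ solve 4 (λ P Q N M → P :* (Q :* N) :* M := N :* (P :* (M :* Q))) refl (2 ^ p) (2 ^ R) ∣ ν ∣ (2 ^ L) ⟩
  ∣ ν ∣ * (2 ^ p * (2 ^ L * 2 ^ R))
    ≡⟨ cong (∣ ν ∣ *_) (sym (trans (^-distribˡ-+-* 2 p (L + R)) (cong (2 ^ p *_) (^-distribˡ-+-* 2 L R)))) ⟩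
  ∣ ν ∣ * 2 ^ (p + (L + R)) ∎
  where open ≤-Reasoning

-- Rational bounds

toℚᵘ-frac : ∀ a b → toℚᵘ (frac a (suc b)) ℚᵘ.≃ mkℚᵘ (ℤ.+ a) b
toℚᵘ-frac a b = ℚ.toℚᵘ-fromℚᵘ (mkℚᵘ (ℤ.+ a) b)

frac-mono-≤ : ∀ {a b c d} → 0 < b → 0 < d → a * d ≤ c * b → frac a b ≤ℚ frac c d
frac-mono-≤ {a} {suc b} {c} {suc d} _ _ ad≤cb = ℚ.toℚᵘ-cancel-≤
  (ℚᵘ.≤-respˡ-≃ (ℚᵘ.≃-sym (toℚᵘ-frac a b)) (ℚᵘ.≤-respʳ-≃ (ℚᵘ.≃-sym (toℚᵘ-frac c d))
    (*≤* (subst₂ ℤ._≤_ (ℤ.pos-* a (suc d)) (ℤ.pos-* c (suc b)) (+≤+ ad≤cb)))))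

frac-nonneg : ∀ a {d} → 0 < d → 0ℚ ≤ℚ frac a d
frac-nonneg a 0<d = frac-mono-≤ {0} {1} (s≤s z≤n) 0<d z≤n

weight-nonneg : ∀ s → 0ℚ ≤ℚ weight s
weight-nonneg s = frac-nonneg 1 (m^n>0 2 (length s))

≤∣↥∣* : ∀ x {d} (B : ℚ) → 0 < d → frac x d ≤ℚ B → x ≤ ℤ.∣ ↥ B ∣ * d
≤∣↥∣* x {suc d} (mkℚ (ℤ.+ n) e _) _ le with ℚᵘ.≤-respˡ-≃ (toℚᵘ-frac x d) (ℚ.toℚᵘ-mono-≤ le)
... | *≤* le′ = ≤-trans (m≤m*n x (suc e))
  (ℤ.drop‿+≤+ (subst₂ ℤ._≤_ (sym (ℤ.pos-* x (suc e))) (sym (ℤ.pos-* n (suc d))) le′))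
≤∣↥∣* x {suc d} (mkℚ ℤ.-[1+ n ] e _) _ le with ℚᵘ.≤-respˡ-≃ (toℚᵘ-frac x d) (ℚ.toℚᵘ-mono-≤ le)
... | *≤* le′ with subst (ℤ._≤ _) (sym (ℤ.pos-* x (suc e))) le′
... | ()

frac-+ : ∀ a c {d} → 0 < d → frac a d +ℚ frac c d ≡ frac (a + c) d
frac-+ a c {suc b} _ = ℚ.toℚᵘ-injective
  (ℚᵘ.≃-trans (ℚ.toℚᵘ-homo-+ (frac a (suc b)) (frac c (suc b)))
  (ℚᵘ.≃-trans (ℚᵘ.+-cong (toℚᵘ-frac a b) (toℚᵘ-frac c b))
  (ℚᵘ.≃-trans sum≃ (ℚᵘ.≃-sym (toℚᵘ-frac (a + c) b)))))
  where
  s = suc b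
  distrib : ∀ (A C S : ℤ.ℤ) → (A ℤ.* S ℤ.+ C ℤ.* S) ℤ.* S ≡ (A ℤ.+ C) ℤ.* (S ℤ.* S)
  distrib = solve-∀
  sum≃ : mkℚᵘ (ℤ.+ a) b ℚᵘ.+ mkℚᵘ (ℤ.+ c) b ℚᵘ.≃ mkℚᵘ (ℤ.+ (a + c)) b
  sum≃ = *≡* (trans (distrib (ℤ.+ a) (ℤ.+ c) (ℤ.+ s)) (sym (cong₂ ℤ._*_ (ℤ.pos-+ a c) (ℤ.pos-* s s))))

frac-≤-double : ∀ a {b d} → 0 < b → 0 < d → d ≤ 2 * b → frac a b ≤ℚ frac a d +ℚ frac a d
frac-≤-double a {b} {d} 0<b 0<d d≤2b =
  subst (frac a b ≤ℚ_) (sym (frac-+ a a 0<d)) (frac-mono-≤ 0<b 0<d (begin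
    a * d       ≤⟨ *-monoʳ-≤ a d≤2b ⟩
    a * (2 * b) ≡⟨ solve 2 (λ A B → A :* (con 2 :* B) := (A :+ A) :* B) refl a b ⟩
    (a + a) * b ∎))
  where open ≤-Reasoning

partialSum-+ : ∀ s a b → partialSum s (a + b) ≡ partialSum s a +ℚ partialSum (s ∘ (a +_)) b
partialSum-+ s a zero    = trans (cong (partialSum s) (+-identityʳ a)) (sym (ℚ.+-identityʳ _))
partialSum-+ s a (suc b) = trans (cong (partialSum s) (+-suc a b))
  (trans (cong (_+ℚ s (a + b)) (partialSum-+ s a b)) (ℚ.+-assoc (partialSum s a) _ (s (a + b))))

partialSum-mono-≤ : ∀ N {s t : ℕ → ℚ} → (∀ i → i < N → s i ≤ℚ t i) →
                    partialSum s N ≤ℚ partialSum t N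
partialSum-mono-≤ zero    le = ℚ.≤-refl
partialSum-mono-≤ (suc N) le =
  ℚ.+-mono-≤ (partialSum-mono-≤ N (λ i i<N → le i (≤-trans i<N (n≤1+n N)))) (le N ≤-refl)

partialSum-nonneg : ∀ N {s : ℕ → ℚ} → (∀ i → 0ℚ ≤ℚ s i) → 0ℚ ≤ℚ partialSum s N
partialSum-nonneg zero    nonneg = ℚ.≤-refl
partialSum-nonneg (suc N) nonneg = ℚ.+-mono-≤ (partialSum-nonneg N nonneg) (nonneg N)

partialSum-monoˡ-≤ : ∀ {s : ℕ → ℚ} → (∀ i → 0ℚ ≤ℚ s i) → ∀ {N M} → N ≤ M →
                     partialSum s N ≤ℚ partialSum s M
partialSum-monoˡ-≤ {s} nonneg {N} N≤M with m≤n⇒∃[o]m+o≡n N≤M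
... | o , refl = begin
  partialSum s N                              ≡⟨ sym (ℚ.+-identityʳ _) ⟩
  partialSum s N +ℚ 0ℚ
    ≤⟨ ℚ.+-monoʳ-≤ (partialSum s N) (partialSum-nonneg o (nonneg ∘ (N +_))) ⟩
  partialSum s N +ℚ partialSum (s ∘ (N +_)) o ≡⟨ sym (partialSum-+ s N o) ⟩
  partialSum s (N + o)                        ∎
  where open ℚ.≤-Reasoning

partialSum-distrib-+ : ∀ N (s t : ℕ → ℚ) →
                       partialSum (λ i → s i +ℚ t i) N ≡ partialSum s N +ℚ partialSum t N
partialSum-distrib-+ zero    s t = refl
partialSum-distrib-+ (suc N) s t = trans (cong (_+ℚ (s N +ℚ t N)) (partialSum-distrib-+ N s t))
  (interchange (CommutativeMonoid.commutativeSemigroup ℚ.+-0-commutativeMonoid)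
               (partialSum s N) (partialSum t N) (s N) (t N))

partialSum-frac : ∀ N h {d} → 0 < d → partialSum (λ i → frac (h i) d) N ≡ frac (sum< N h) d
partialSum-frac zero    h {suc d} _ = sym (ℚ.0/n≡0 (suc d))
partialSum-frac (suc N) h {d} 0<d = begin
  partialSum (λ i → frac (h i) d) N +ℚ frac (h N) d ≡⟨ cong (_+ℚ frac (h N) d) (partialSum-frac N h 0<d) ⟩
  frac (sum< N h) d +ℚ frac (h N) d                 ≡⟨ frac-+ (sum< N h) (h N) 0<d ⟩
  frac (sum< N h + h N) d                           ≡⟨ cong (λ n → frac n d) (sym (sum<-suc N h)) ⟩
  frac (sum< (suc N) h) d                           ∎
  where open ≡-Reasoning

Summable-≤-double : ∀ {s t : ℕ → ℚ} → (∀ i → s i ≤ℚ t i +ℚ t i) → Summable t → Summable s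
Summable-≤-double {s} {t} le (B , bounded) = B +ℚ B , λ N →
  ℚ.≤-trans (partialSum-mono-≤ N (λ i _ → le i))
            (subst (_≤ℚ B +ℚ B) (sym (partialSum-distrib-+ N t t)) (ℚ.+-mono-≤ (bounded N) (bounded N)))

-- Enumerating all binary strings level by level

levelOffset : ℕ → ℕ → ℕ
levelOffset j zero    = 0
levelOffset j (suc d) = 2 ^ j + levelOffset (suc j) d

levelOffset-suc : ∀ j d → levelOffset j (suc d) ≡ levelOffset j d + 2 ^ (j + d)
levelOffset-suc j zero    = trans (+-identityʳ (2 ^ j)) (cong (2 ^_) (sym (+-identityʳ j)))
levelOffset-suc j (suc d) = begin
  2 ^ j + levelOffset (suc j) (suc d)               ≡⟨ cong (2 ^ j +_) (levelOffset-suc (suc j) d) ⟩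
  2 ^ j + (levelOffset (suc j) d + 2 ^ (suc j + d)) ≡⟨ sym (+-assoc (2 ^ j) _ _) ⟩
  levelOffset j (suc d) + 2 ^ (suc j + d)           ≡⟨ cong (λ e → levelOffset j (suc d) + 2 ^ e) (sym (+-suc j d)) ⟩
  levelOffset j (suc d) + 2 ^ (j + suc d)           ∎
  where open ≡-Reasoning

≤levelOffset : ∀ j d → d ≤ levelOffset j d
≤levelOffset j zero    = z≤n
≤levelOffset j (suc d) = +-mono-≤ (m^n>0 2 j) (≤levelOffset (suc j) d)

-- stringAt fuel j t is entry t of the enumeration of the strings of length ≥ j; the fuel only
-- serves termination, and fuel n suffices for index n.
stringAt : ℕ → ℕ → ℕ → List Bool
stringAt fuel j t with t <? 2 ^ j
... | yes _ = binary j t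
stringAt zero       j t | no _ = []
stringAt (suc fuel) j t | no _ = stringAt fuel (suc j) (t ∸ 2 ^ j)

strings : ℕ → List Bool
strings n = stringAt n 0 n

stringAt-here : ∀ fuel j {t} → t < 2 ^ j → stringAt fuel j t ≡ binary j t
stringAt-here fuel j {t} t<2^j with t <? 2 ^ j
... | yes _     = refl
... | no  t≮2^j = contradiction t<2^j t≮2^j

stringAt-next : ∀ fuel j t → stringAt (suc fuel) j (2 ^ j + t) ≡ stringAt fuel (suc j) t
stringAt-next fuel j t with 2 ^ j + t <? 2 ^ j
... | yes lt = contradiction lt (m+n≮m (2 ^ j) t)
... | no  _  = cong (stringAt fuel (suc j)) (m+n∸m≡n (2 ^ j) t)

stringAt-levelOffset : ∀ d j {t} fuel → t < 2 ^ (j + d) → levelOffset j d + t ≤ fuel →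
                       stringAt fuel j (levelOffset j d + t) ≡ binary (j + d) t
stringAt-levelOffset zero j {t} fuel t< _ =
  trans (stringAt-here fuel j (subst (λ e → t < 2 ^ e) (+-identityʳ j) t<))
        (cong (λ e → binary e t) (sym (+-identityʳ j)))
stringAt-levelOffset (suc d) j zero t< le =
  contradiction (≤-trans (≤-trans (m^n>0 2 j) (m≤m+n _ _)) (≤-trans (m≤m+n _ _) le)) (λ ())
stringAt-levelOffset (suc d) j {t} (suc fuel) t< le = begin
  stringAt (suc fuel) j (2 ^ j + levelOffset (suc j) d + t)
    ≡⟨ cong (stringAt (suc fuel) j) (+-assoc (2 ^ j) _ t) ⟩
  stringAt (suc fuel) j (2 ^ j + (levelOffset (suc j) d + t))
    ≡⟨ stringAt-next fuel j _ ⟩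
  stringAt fuel (suc j) (levelOffset (suc j) d + t)
    ≡⟨ stringAt-levelOffset d (suc j) fuel (subst (λ e → t < 2 ^ e) (+-suc j d) t<) le′ ⟩
  binary (suc j + d) t
    ≡⟨ cong (λ e → binary e t) (sym (+-suc j d)) ⟩
  binary (j + suc d) t ∎
  where
  open ≡-Reasoning
  le′ : levelOffset (suc j) d + t ≤ fuel
  le′ = ≤-pred (≤-trans (+-monoˡ-≤ _ (m^n>0 2 j)) (subst (_≤ suc fuel) (+-assoc (2 ^ j) _ t) le))

strings-levelOffset : ∀ ℓ {t} → t < 2 ^ ℓ → strings (levelOffset 0 ℓ + t) ≡ binary ℓ t
strings-levelOffset ℓ t< = stringAt-levelOffset ℓ 0 _ t< ≤-refl

-- Blocks and heavy strings

module Blocks (L : ℕ → ℕ) where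

  blockStart : ℕ → ℕ
  blockStart zero    = 0
  blockStart (suc i) = blockStart i + L i

  block : Cantor → ℕ → ℕ
  block x i = value (L i) (λ q → x (blockStart i + q))

  block<2^ : ∀ x i → block x i < 2 ^ L i
  block<2^ x i = value<2^ (L i) (λ q → x (blockStart i + q))

  block-cong : ∀ {ℓ x y} i → blockStart (suc i) ≤ ℓ → (∀ q → q < ℓ → x q ≡ y q) →
               block x i ≡ block y i
  block-cong i le eq =
    value-cong (L i) (λ q q<L → eq (blockStart i + q) (≤-trans (+-monoʳ-< (blockStart i) q<L) le))

module HeavyStrings (L : ℕ → ℕ) {n : ℕ → ℕ} (ν : ∀ i → Subset (n i)) (m : ℕ) where

  open Blocks L

  -- Only blocks inside the first ℓ bits count, so hits ℓ x depends only on those bits.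
  hit : ℕ → Cantor → ℕ → ℕ
  hit ℓ x i = when (blockStart (suc i) ≤? ℓ) (indicator (ν i) (block x i))

  hits : ℕ → Cantor → ℕ
  hits ℓ x = sum< ℓ (hit ℓ x)

  hits-cong : ∀ ℓ {x y} → (∀ q → q < ℓ → x q ≡ y q) → hits ℓ x ≡ hits ℓ y
  hits-cong ℓ eq = sum<-cong ℓ (λ i _ →
    when-congʳ (blockStart (suc i) ≤? ℓ) (λ le → cong (indicator (ν i)) (block-cong i le eq)))

  hit-monoˡ-≤ : ∀ x {ℓ ℓ′} → ℓ ≤ ℓ′ → ∀ i → hit ℓ x i ≤ hit ℓ′ x i
  hit-monoˡ-≤ x {ℓ} {ℓ′} ℓ≤ℓ′ i =
    when-mono (λ le → ≤-trans le ℓ≤ℓ′) (blockStart (suc i) ≤? ℓ) (blockStart (suc i) ≤? ℓ′)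

  hits-monoˡ-≤ : ∀ x {ℓ ℓ′} → ℓ ≤ ℓ′ → hits ℓ x ≤ hits ℓ′ x
  hits-monoˡ-≤ x {ℓ} {ℓ′} ℓ≤ℓ′ =
    ≤-trans (sum<-mono-≤ ℓ (λ i _ → hit-monoˡ-≤ x ℓ≤ℓ′ i)) (sum<-monoˡ-≤ (hit ℓ′ x) ℓ≤ℓ′)

  hits-unbounded : ∀ x → InfinitelyMany (λ i → indicator (ν i) (block x i) ≡ 1) →
                   ∀ M → Σ ℕ λ ℓ → M ≤ hits ℓ x
  hits-unbounded x inf zero    = 0 , z≤n
  hits-unbounded x inf (suc M) with hits-unbounded x inf M
  ... | ℓ , M≤hits with inf ℓ
  ... | i , ℓ≤i , i∈ν with m≤n⇒∃[o]m+o≡n ℓ≤i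
  ... | j , refl = ℓ′ , (begin
    suc M                          ≤⟨ +-monoʳ-≤ 1 M≤hits ⟩
    suc (hits ℓ x)                 ≡⟨ +-comm 1 _ ⟩
    hits ℓ x + 1                   ≤⟨ +-mono-≤ (sum<-mono-≤ ℓ (λ k _ → hit-monoˡ-≤ x ℓ≤ℓ′ k))
                                               (≤-reflexive (sym hit-i)) ⟩
    sum< ℓ (hit ℓ′ x) + hit ℓ′ x i ≤⟨ sum<-+-≤ (hit ℓ′ x) ℓ (m<m+n j (s≤s z≤n)) ⟩
    sum< (ℓ + (j + suc (blockStart (suc i)))) (hit ℓ′ x)
                                   ≡⟨ cong (λ k → sum< k (hit ℓ′ x)) (sym (+-assoc ℓ j _)) ⟩
    hits ℓ′ x                      ∎)
    where
    open ≤-Reasoning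
    ℓ′ = i + suc (blockStart (suc i))
    ℓ≤ℓ′ : ℓ ≤ ℓ′
    ℓ≤ℓ′ = ≤-trans (m≤m+n ℓ j) (m≤m+n i _)
    hit-i : hit ℓ′ x i ≡ 1
    hit-i = trans (when-yes (blockStart (suc i) ≤? ℓ′) (≤-trans (n≤1+n _) (m≤n+m _ i))) i∈ν

  #hitting : ℕ → ℕ → ℕ
  #hitting ℓ i = sumStrings ℓ (λ s → hit ℓ (pad s) i)

  #hitting-≤ : ∀ ℓ i → #hitting ℓ i * 2 ^ L i ≤ ∣ ν i ∣ * 2 ^ ℓ
  #hitting-≤ ℓ i = bound (blockStart (suc i) ≤? ℓ)
    where
    bound : (d : Dec (blockStart (suc i) ≤ ℓ)) →
            sumStrings ℓ (λ s → when d (indicator (ν i) (block (pad s) i))) * 2 ^ L i ≤ ∣ ν i ∣ * 2 ^ ℓ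
    bound (no _)   = subst (_≤ ∣ ν i ∣ * 2 ^ ℓ)
      (sym (cong (_* 2 ^ L i) (trans (sumStrings-const ℓ 0) (*-zeroʳ (2 ^ ℓ))))) z≤n
    bound (yes le) = subst
      (λ ℓ → sumStrings ℓ (λ s → indicator (ν i) (block (pad s) i)) * 2 ^ L i ≤ ∣ ν i ∣ * 2 ^ ℓ)
      (trans (sym (+-assoc (blockStart i) (L i) _)) (m+[n∸m]≡n le))
      (sumStrings-indicator (blockStart i) (L i) (ℓ ∸ blockStart (suc i)) (ν i))

  Heavy : ℕ → Cantor → Set
  Heavy ℓ x = m ≤ hits ℓ x

  heavy? : ∀ ℓ x → Dec (Heavy ℓ x)
  heavy? ℓ x = m ≤? hits ℓ x

  MinimalHeavy : ℕ → Cantor → Set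
  MinimalHeavy ℓ x = Heavy ℓ x × ¬ Heavy (pred ℓ) x

  minimalHeavy? : ∀ ℓ x → Dec (MinimalHeavy ℓ x)
  minimalHeavy? ℓ x = heavy? ℓ x ×-dec ¬? (heavy? (pred ℓ) x)

  #heavy : ℕ → ℕ
  #heavy ℓ = sumStrings ℓ (λ s → 𝟙 (heavy? ℓ (pad s)))

  #minimalHeavy : ℕ → ℕ
  #minimalHeavy ℓ = sumStrings ℓ (λ s → 𝟙 (minimalHeavy? ℓ (pad s)))

  #minimalHeavy≤#heavy : ∀ ℓ → #minimalHeavy ℓ ≤ #heavy ℓ
  #minimalHeavy≤#heavy ℓ =
    sumStrings-mono-≤ ℓ (λ s _ → when-mono proj₁ (minimalHeavy? ℓ (pad s)) (heavy? ℓ (pad s)))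

  m*#heavy≤ : ∀ ℓ → m * #heavy ℓ ≤ sum< ℓ (#hitting ℓ)
  m*#heavy≤ ℓ = begin
    m * #heavy ℓ                                  ≡⟨ sym (sumStrings-*ˡ ℓ m _) ⟩
    sumStrings ℓ (λ s → m * 𝟙 (heavy? ℓ (pad s))) ≤⟨ sumStrings-mono-≤ ℓ (λ s _ → m*𝟙≤ (heavy? ℓ (pad s))) ⟩
    sumStrings ℓ (λ s → hits ℓ (pad s))           ≡⟨ sumStrings-sum< ℓ ℓ (λ i s → hit ℓ (pad s) i) ⟩
    sum< ℓ (#hitting ℓ)                           ∎
    where open ≤-Reasoning

  heavy-++ : ∀ {ℓ} u r → length u ≡ ℓ → Heavy ℓ (pad u) → Heavy ℓ (pad (u ++ r))
  heavy-++ {ℓ} u r refl = subst (m ≤_) (hits-cong ℓ (λ q q<u → sym (pad-++ˡ u r q<u)))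

  heavy-snoc : ∀ {ℓ} u b → length u ≡ ℓ → Heavy ℓ (pad u) → Heavy (suc ℓ) (pad (u ++ b ∷ []))
  heavy-snoc u b eq h = ≤-trans (heavy-++ u (b ∷ []) eq h) (hits-monoˡ-≤ (pad (u ++ b ∷ [])) (n≤1+n _))

  #heavy-children : ∀ {ℓ} u → length u ≡ ℓ →
    let minimal b = 𝟙 (minimalHeavy? (suc ℓ) (pad (u ++ b ∷ [])))
        heavy   b = 𝟙 (heavy? (suc ℓ) (pad (u ++ b ∷ [])))
    in 2 * 𝟙 (heavy? ℓ (pad u)) + (minimal false + minimal true) ≤ heavy false + heavy true
  #heavy-children {ℓ} u eq with heavy? ℓ (pad u)
  ... | yes h = ≤-reflexive (trans (cong (2 +_) (cong₂ _+_ (minimal-no false) (minimal-no true)))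
                                   (sym (cong₂ _+_ (heavy-yes false) (heavy-yes true))))
    where
    heavy-yes : ∀ b → 𝟙 (heavy? (suc ℓ) (pad (u ++ b ∷ []))) ≡ 1
    heavy-yes b = when-yes (heavy? (suc ℓ) _) (heavy-snoc u b eq h)
    minimal-no : ∀ b → 𝟙 (minimalHeavy? (suc ℓ) (pad (u ++ b ∷ []))) ≡ 0
    minimal-no b = when-no (minimalHeavy? (suc ℓ) _) (λ (_ , ¬h) → ¬h (heavy-++ u (b ∷ []) eq h))
  ... | no _ = +-mono-≤ (when-mono proj₁ (minimalHeavy? _ _) (heavy? _ _))
                        (when-mono proj₁ (minimalHeavy? _ _) (heavy? _ _))

  2*#heavy+#minimalHeavy≤#heavy : ∀ ℓ → 2 * #heavy ℓ + #minimalHeavy (suc ℓ) ≤ #heavy (suc ℓ)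
  2*#heavy+#minimalHeavy≤#heavy ℓ = begin
    2 * #heavy ℓ + #minimalHeavy (suc ℓ)
      ≡⟨ cong₂ _+_ (sym (sumStrings-*ˡ ℓ 2 _))
                   (sumStrings-snoc ℓ (λ s → 𝟙 (minimalHeavy? (suc ℓ) (pad s)))) ⟩
    sumStrings ℓ (λ u → 2 * 𝟙 (heavy? ℓ (pad u))) + sumStrings ℓ (λ u → minimal u false + minimal u true)
      ≡⟨ sym (sumStrings-distrib-+ ℓ _ _) ⟩
    sumStrings ℓ (λ u → 2 * 𝟙 (heavy? ℓ (pad u)) + (minimal u false + minimal u true))
      ≤⟨ sumStrings-mono-≤ ℓ #heavy-children ⟩
    sumStrings ℓ (λ u → heavy u false + heavy u true)
      ≡⟨ sym (sumStrings-snoc ℓ (λ s → 𝟙 (heavy? (suc ℓ) (pad s)))) ⟩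
    #heavy (suc ℓ) ∎
    where
    open ≤-Reasoning
    minimal heavy : List Bool → Bool → ℕ
    minimal u b = 𝟙 (minimalHeavy? (suc ℓ) (pad (u ++ b ∷ [])))
    heavy   u b = 𝟙 (heavy? (suc ℓ) (pad (u ++ b ∷ [])))

  minimalHeavy-prefix : 0 < m → ∀ x → InfinitelyMany (λ i → indicator (ν i) (block x i) ≡ 1) →
                        Σ ℕ λ ℓ → MinimalHeavy ℓ (pad (applyUpTo x ℓ))
  minimalHeavy-prefix 0<m x inf with hits-unbounded x inf m
  ... | ℓ , m≤hits with first-crossing (λ ℓ → hits ℓ x) 0<m ℓ m≤hits
  ... | ℓ′ , light , heavy = suc ℓ′ ,
        subst (m ≤_) (prefix-hits (suc ℓ′) ≤-refl) heavy ,
        λ h → <⇒≱ light (subst (m ≤_) (sym (prefix-hits ℓ′ (n≤1+n ℓ′))) h)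
    where
    prefix-hits : ∀ ℓ → ℓ ≤ suc ℓ′ → hits ℓ x ≡ hits ℓ (pad (applyUpTo x (suc ℓ′)))
    prefix-hits ℓ ℓ≤ = hits-cong ℓ (λ q q<ℓ → sym (pad-applyUpTo x (suc ℓ′) (≤-trans q<ℓ ℓ≤)))

-- The cover

module Cover (L : ℕ → ℕ) {n : ℕ → ℕ} (ν : ∀ i → Subset (n i)) (m k : ℕ) where

  open HeavyStrings L ν m

  -- Padding a string of length ℓ by ℓ + k + 2 bits makes the padded strings of level ℓ weigh
  -- at most 2^-(ℓ+k+2) in total.
  cover : List Bool → List Bool
  cover s with minimalHeavy? (length s) (pad s)
  ... | yes _ = s
  ... | no  _ = s ++ replicate (length s + k + 2) false

  cover-minimal : ∀ s → MinimalHeavy (length s) (pad s) → cover s ≡ s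
  cover-minimal s min with minimalHeavy? (length s) (pad s)
  ... | yes _    = refl
  ... | no  ¬min = contradiction min ¬min

  coverWeight : ℕ → ℚ
  coverWeight i = weight (cover (strings i))

  -- Weights of the first ℓ levels are bounded over the common denominator 4^ℓ · 2^k.
  denominator : ℕ → ℕ
  denominator ℓ = 2 ^ ℓ * 2 ^ ℓ * 2 ^ k

  denominator>0 : ∀ ℓ → 0 < denominator ℓ
  denominator>0 ℓ = *-mono-≤ (*-mono-≤ (m^n>0 2 ℓ) (m^n>0 2 ℓ)) (m^n>0 2 k)

  cost : ℕ → List Bool → ℕ
  cost ℓ s = 2 ^ ℓ * 2 ^ k * 4 * 𝟙 (minimalHeavy? ℓ (pad s)) + 1

  2^length-padded : ∀ s → 2 ^ length (s ++ replicate (length s + k + 2) false)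
                          ≡ 2 ^ length s * (2 ^ length s * 2 ^ k * 4)
  2^length-padded s = begin
    2 ^ length (s ++ replicate (j + k + 2) false)
      ≡⟨ cong (2 ^_) (trans (length-++ s) (cong (j +_) (length-replicate (j + k + 2)))) ⟩
    2 ^ (j + (j + k + 2))       ≡⟨ ^-distribˡ-+-* 2 j _ ⟩
    2 ^ j * 2 ^ (j + k + 2)     ≡⟨ cong (2 ^ j *_) (^-distribˡ-+-* 2 (j + k) 2) ⟩
    2 ^ j * (2 ^ (j + k) * 4)   ≡⟨ cong (λ e → 2 ^ j * (e * 4)) (^-distribˡ-+-* 2 j k) ⟩
    2 ^ j * (2 ^ j * 2 ^ k * 4) ∎
    where
    open ≡-Reasoning
    j = length s

  weight-cover : ∀ s → weight (cover s) ≤ℚ frac (cost (length s) s) (denominator (suc (length s)))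
  weight-cover s with minimalHeavy? (length s) (pad s)
  ... | yes _ = frac-mono-≤ {1} {2 ^ j} (m^n>0 2 j) (denominator>0 (suc j)) (begin
    1 * denominator (suc j)
      ≡⟨ solve 2 (λ J K → con 1 :* ((con 2 :* J) :* (con 2 :* J) :* K) := J :* K :* con 4 :* con 1 :* J)
               refl (2 ^ j) (2 ^ k) ⟩
    2 ^ j * 2 ^ k * 4 * 1 * 2 ^ j       ≤⟨ *-monoˡ-≤ (2 ^ j) (m≤m+n (2 ^ j * 2 ^ k * 4 * 1) 1) ⟩
    (2 ^ j * 2 ^ k * 4 * 1 + 1) * 2 ^ j ∎)
    where
    open ≤-Reasoning
    j = length s
  ... | no  _ = frac-mono-≤ {1} {2 ^ length padded} (m^n>0 2 (length padded)) (denominator>0 (suc j))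
    (≤-reflexive (begin
      1 * denominator (suc j)
        ≡⟨ solve 2 (λ J K → con 1 :* ((con 2 :* J) :* (con 2 :* J) :* K)
                          := (J :* K :* con 4 :* con 0 :+ con 1) :* (J :* (J :* K :* con 4))) refl (2 ^ j) (2 ^ k) ⟩
      (2 ^ j * 2 ^ k * 4 * 0 + 1) * (2 ^ j * (2 ^ j * 2 ^ k * 4))
        ≡⟨ cong ((2 ^ j * 2 ^ k * 4 * 0 + 1) *_) (sym (2^length-padded s)) ⟩
      (2 ^ j * 2 ^ k * 4 * 0 + 1) * 2 ^ length padded ∎))
    where
    open ≡-Reasoning
    j = length s
    padded = s ++ replicate (j + k + 2) false

  sumStrings-cost : ∀ ℓ → sumStrings ℓ (cost ℓ) ≡ 2 ^ ℓ * 2 ^ k * 4 * #minimalHeavy ℓ + 2 ^ ℓ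
  sumStrings-cost ℓ = trans (sumStrings-distrib-+ ℓ _ (λ _ → 1))
    (cong₂ _+_ (sumStrings-*ˡ ℓ (2 ^ ℓ * 2 ^ k * 4) _) (trans (sumStrings-const ℓ 1) (*-identityʳ (2 ^ ℓ))))

  partialSum-level : ∀ ℓ → partialSum (coverWeight ∘ (levelOffset 0 ℓ +_)) (2 ^ ℓ)
                             ≤ℚ frac (sumStrings ℓ (cost ℓ)) (denominator (suc ℓ))
  partialSum-level ℓ = begin
    partialSum (coverWeight ∘ (levelOffset 0 ℓ +_)) (2 ^ ℓ)
      ≤⟨ partialSum-mono-≤ (2 ^ ℓ) entry≤ ⟩
    partialSum (λ t → frac (cost ℓ (binary ℓ t)) (denominator (suc ℓ))) (2 ^ ℓ)
      ≡⟨ partialSum-frac (2 ^ ℓ) (cost ℓ ∘ binary ℓ) (denominator>0 (suc ℓ)) ⟩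
    frac (sum< (2 ^ ℓ) (cost ℓ ∘ binary ℓ)) (denominator (suc ℓ))
      ≡⟨ cong (λ c → frac c (denominator (suc ℓ))) (sum<-binary ℓ (cost ℓ)) ⟩
    frac (sumStrings ℓ (cost ℓ)) (denominator (suc ℓ)) ∎
    where
    open ℚ.≤-Reasoning
    entry≤ : ∀ t → t < 2 ^ ℓ →
             coverWeight (levelOffset 0 ℓ + t) ≤ℚ frac (cost ℓ (binary ℓ t)) (denominator (suc ℓ))
    entry≤ t t< = subst₂ (λ s j → weight (cover s) ≤ℚ frac (cost j (binary ℓ t)) (denominator (suc j)))
                         (sym (strings-levelOffset ℓ t<)) (length-binary ℓ t) (weight-cover (binary ℓ t))

  massNumerator : ℕ → ℕ
  massNumerator zero    = 0
  massNumerator (suc ℓ) = 4 * massNumerator ℓ + sumStrings ℓ (cost ℓ)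

  partialSum-levels : ∀ ℓ →
    partialSum coverWeight (levelOffset 0 ℓ) ≤ℚ frac (massNumerator ℓ) (denominator ℓ)
  partialSum-levels zero    = frac-nonneg 0 (denominator>0 0)
  partialSum-levels (suc ℓ) = begin
    partialSum coverWeight (levelOffset 0 (suc ℓ))
      ≡⟨ cong (partialSum coverWeight) (levelOffset-suc 0 ℓ) ⟩
    partialSum coverWeight (levelOffset 0 ℓ + 2 ^ ℓ)
      ≡⟨ partialSum-+ coverWeight (levelOffset 0 ℓ) (2 ^ ℓ) ⟩
    partialSum coverWeight (levelOffset 0 ℓ) +ℚ partialSum (coverWeight ∘ (levelOffset 0 ℓ +_)) (2 ^ ℓ)
      ≤⟨ ℚ.+-mono-≤ (ℚ.≤-trans (partialSum-levels ℓ) rescale) (partialSum-level ℓ) ⟩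
    frac (4 * massNumerator ℓ) (denominator (suc ℓ)) +ℚ frac (sumStrings ℓ (cost ℓ)) (denominator (suc ℓ))
      ≡⟨ frac-+ (4 * massNumerator ℓ) _ (denominator>0 (suc ℓ)) ⟩
    frac (massNumerator (suc ℓ)) (denominator (suc ℓ)) ∎
    where
    open ℚ.≤-Reasoning
    rescale : frac (massNumerator ℓ) (denominator ℓ) ≤ℚ frac (4 * massNumerator ℓ) (denominator (suc ℓ))
    rescale = frac-mono-≤ (denominator>0 ℓ) (denominator>0 (suc ℓ)) (≤-reflexive
      (solve 3 (λ M J K → M :* ((con 2 :* J) :* (con 2 :* J) :* K) := con 4 :* M :* (J :* J :* K))
             refl (massNumerator ℓ) (2 ^ ℓ) (2 ^ k)))

  paddingNumerator : ℕ → ℕ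
  paddingNumerator zero    = 0
  paddingNumerator (suc ℓ) = 4 * paddingNumerator ℓ + 2 ^ ℓ

  paddingNumerator-closed : ∀ ℓ → 2 * paddingNumerator ℓ + 2 ^ ℓ ≡ 2 ^ ℓ * 2 ^ ℓ
  paddingNumerator-closed zero    = refl
  paddingNumerator-closed (suc ℓ) = begin
    2 * (4 * P + A) + 2 * A ≡⟨ solve 2 (λ P A → con 2 :* (con 4 :* P :+ A) :+ con 2 :* A
                                             := con 4 :* (con 2 :* P :+ A)) refl P A ⟩
    4 * (2 * P + A)         ≡⟨ cong (4 *_) (paddingNumerator-closed ℓ) ⟩
    4 * (A * A)             ≡⟨ solve 1 (λ A → con 4 :* (A :* A) := (con 2 :* A) :* (con 2 :* A)) refl A ⟩
    2 * A * (2 * A)         ∎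
    where
    open ≡-Reasoning
    P = paddingNumerator ℓ
    A = 2 ^ ℓ

  -- The minimal heavy strings of level ℓ + 1 are paid for by 2 * #heavy ℓ + #minimalHeavy (ℓ + 1)
  -- ≤ #heavy (ℓ + 1), which telescopes.
  massNumerator≤ : ∀ ℓ →
    massNumerator (suc ℓ) ≤ 2 ^ suc ℓ * 2 ^ k * (2 * #heavy ℓ) + paddingNumerator (suc ℓ)
  massNumerator≤ zero = begin
    sumStrings 0 (cost 0)               ≡⟨ sumStrings-cost 0 ⟩
    1 * 2 ^ k * 4 * #minimalHeavy 0 + 1 ≤⟨ +-monoˡ-≤ 1 (*-monoʳ-≤ (1 * 2 ^ k * 4) (#minimalHeavy≤#heavy 0)) ⟩
    1 * 2 ^ k * 4 * #heavy 0 + 1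
      ≡⟨ cong (_+ 1) (solve 2 (λ K H → con 1 :* K :* con 4 :* H := (con 2 :* con 1) :* K :* (con 2 :* H))
                              refl (2 ^ k) (#heavy 0)) ⟩
    2 * 1 * 2 ^ k * (2 * #heavy 0) + 1  ∎
    where open ≤-Reasoning
  massNumerator≤ (suc ℓ) = begin
    4 * massNumerator (suc ℓ) + sumStrings (suc ℓ) (cost (suc ℓ))
      ≤⟨ +-mono-≤ (*-monoʳ-≤ 4 (massNumerator≤ ℓ)) (≤-reflexive (sumStrings-cost (suc ℓ))) ⟩
    4 * (A * K * (2 * #heavy ℓ) + P) + (A * K * 4 * #minimalHeavy (suc ℓ) + A)
      ≡⟨ solve 5 (λ A K H G P → con 4 :* (A :* K :* (con 2 :* H) :+ P) :+ (A :* K :* con 4 :* G :+ A)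
                             := (con 2 :* A) :* K :* (con 2 :* (con 2 :* H :+ G)) :+ (con 4 :* P :+ A))
               refl A K (#heavy ℓ) (#minimalHeavy (suc ℓ)) P ⟩
    2 * A * K * (2 * (2 * #heavy ℓ + #minimalHeavy (suc ℓ))) + paddingNumerator (suc (suc ℓ))
      ≤⟨ +-monoˡ-≤ _ (*-monoʳ-≤ (2 * A * K) (*-monoʳ-≤ 2 (2*#heavy+#minimalHeavy≤#heavy ℓ))) ⟩
    2 * A * K * (2 * #heavy (suc ℓ)) + paddingNumerator (suc (suc ℓ)) ∎
    where
    open ≤-Reasoning
    A = 2 ^ suc ℓ
    K = 2 ^ k
    P = paddingNumerator (suc ℓ)

  module _ (few-heavy : ∀ ℓ → #heavy ℓ * (2 ^ k * 4) ≤ 2 ^ ℓ) where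

    massNumerator≤4^ : ∀ ℓ → massNumerator ℓ ≤ 2 ^ ℓ * 2 ^ ℓ
    massNumerator≤4^ zero    = z≤n
    massNumerator≤4^ (suc ℓ) = *-cancelˡ-≤ 2 (begin
      2 * massNumerator (suc ℓ)              ≤⟨ *-monoʳ-≤ 2 (massNumerator≤ ℓ) ⟩
      2 * (2 * A * K * (2 * #heavy ℓ) + P)
        ≡⟨ solve 4 (λ A K H P → con 2 :* ((con 2 :* A) :* K :* (con 2 :* H) :+ P)
                             := con 2 :* (A :* (H :* (K :* con 4))) :+ con 2 :* P) refl A K (#heavy ℓ) P ⟩
      2 * (A * (#heavy ℓ * (K * 4))) + 2 * P ≤⟨ +-mono-≤ (*-monoʳ-≤ 2 (*-monoʳ-≤ A (few-heavy ℓ)))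
                                                         (m≤m+n (2 * P) _) ⟩
      2 * (A * A) + (2 * P + 2 ^ suc ℓ)      ≡⟨ cong (2 * (A * A) +_) (paddingNumerator-closed (suc ℓ)) ⟩
      2 * (A * A) + 2 * A * (2 * A)          ≤⟨ m≤m+n _ (2 * (A * A)) ⟩
      2 * (A * A) + 2 * A * (2 * A) + 2 * (A * A)
        ≡⟨ solve 1 (λ A → con 2 :* (A :* A) :+ (con 2 :* A) :* (con 2 :* A) :+ con 2 :* (A :* A)
                       := con 2 :* ((con 2 :* A) :* (con 2 :* A))) refl A ⟩
      2 * (2 * A * (2 * A))                  ∎)
      where
      open ≤-Reasoning
      A = 2 ^ ℓ
      K = 2 ^ k
      P = paddingNumerator (suc ℓ)

    partialSum-coverWeight : ∀ N → partialSum coverWeight N ≤ℚ frac 1 (2 ^ k)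
    partialSum-coverWeight N = begin
      partialSum coverWeight N
        ≤⟨ partialSum-monoˡ-≤ (λ i → weight-nonneg (cover (strings i))) (≤levelOffset 0 N) ⟩
      partialSum coverWeight (levelOffset 0 N)
        ≤⟨ partialSum-levels N ⟩
      frac (massNumerator N) (denominator N)
        ≤⟨ frac-mono-≤ (denominator>0 N) (m^n>0 2 k)
             (≤-trans (*-monoˡ-≤ (2 ^ k) (massNumerator≤4^ N)) (≤-reflexive (sym (*-identityˡ _)))) ⟩
      frac 1 (2 ^ k) ∎
      where open ℚ.≤-Reasoning

  cover-≺ : 0 < m → ∀ x → InfinitelyMany (λ i → indicator (ν i) (Blocks.block L x i) ≡ 1) →
            Σ ℕ λ i → cover (strings i) ≺ x
  cover-≺ 0<m x inf with minimalHeavy-prefix 0<m x inf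
  ... | ℓ , min = levelOffset 0 ℓ + value ℓ (pad s) , subst (_≺ x) (sym cover≡s) (applyUpTo≺ x ℓ)
    where
    s = applyUpTo x ℓ
    |s|≡ℓ = length-applyUpTo x ℓ
    string≡s : strings (levelOffset 0 ℓ + value ℓ (pad s)) ≡ s
    string≡s = trans (strings-levelOffset ℓ (value<2^ ℓ (pad s)))
                     (subst (λ j → binary j (value j (pad s)) ≡ s) |s|≡ℓ (binary-value s))
    cover≡s : cover (strings (levelOffset 0 ℓ + value ℓ (pad s))) ≡ s
    cover≡s = trans (cong cover string≡s)
                    (cover-minimal s (subst (λ j → MinimalHeavy j (pad s)) (sym |s|≡ℓ) min))

Null-blockwise : (L : ℕ → ℕ) {n : ℕ → ℕ} (ν : ∀ i → Subset (n i)) →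
                 Summable (λ i → frac ∣ ν i ∣ (2 ^ L i)) →
                 Null (λ x → InfinitelyMany (λ i → indicator (ν i) (Blocks.block L x i) ≡ 1))
Null-blockwise L ν (B , bounded) k = cover ∘ strings , partialSum-coverWeight few-heavy , cover-≺ 0<m
  where
  K = ℤ.∣ ↥ B ∣
  -- Every string length has at most K · 2^ℓ hits in total, so with this m Markov's inequality
  -- leaves at most a 2^-(k+2) fraction of heavy strings.
  m = suc K * (2 ^ k * 4)
  open HeavyStrings L ν m
  open Cover L ν m k

  0<m : 0 < m
  0<m = *-mono-≤ {1} {suc K} (s≤s z≤n) (*-mono-≤ (m^n>0 2 k) (s≤s z≤n))

  expected-hits : ∀ ℓ → sum< ℓ (#hitting ℓ) ≤ K * 2 ^ ℓ
  expected-hits ℓ = ≤∣↥∣* (sum< ℓ (#hitting ℓ)) B (m^n>0 2 ℓ) (begin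
    frac (sum< ℓ (#hitting ℓ)) (2 ^ ℓ)
      ≡⟨ sym (partialSum-frac ℓ (#hitting ℓ) (m^n>0 2 ℓ)) ⟩
    partialSum (λ i → frac (#hitting ℓ i) (2 ^ ℓ)) ℓ
      ≤⟨ partialSum-mono-≤ ℓ (λ i _ → frac-mono-≤ (m^n>0 2 ℓ) (m^n>0 2 (L i)) (#hitting-≤ ℓ i)) ⟩
    partialSum (λ i → frac ∣ ν i ∣ (2 ^ L i)) ℓ
      ≤⟨ bounded ℓ ⟩
    B ∎)
    where open ℚ.≤-Reasoning

  few-heavy : ∀ ℓ → #heavy ℓ * (2 ^ k * 4) ≤ 2 ^ ℓ
  few-heavy ℓ = *-cancelˡ-≤ (suc K) (begin
    suc K * (#heavy ℓ * (2 ^ k * 4))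
      ≡⟨ solve 3 (λ S H C → S :* (H :* C) := S :* C :* H) refl (suc K) (#heavy ℓ) (2 ^ k * 4) ⟩
    m * #heavy ℓ        ≤⟨ m*#heavy≤ ℓ ⟩
    sum< ℓ (#hitting ℓ) ≤⟨ expected-hits ℓ ⟩
    K * 2 ^ ℓ           ≤⟨ *-monoˡ-≤ (2 ^ ℓ) (n≤1+n K) ⟩
    suc K * 2 ^ ℓ       ∎)
    where open ≤-Reasoning

Null-mono : ∀ {A B : Cantor → Set} → (∀ x → A x → B x) → Null B → Null A
Null-mono A⊆B null k with null k
... | c , small , covers = c , small , λ x → covers x ∘ A⊆B x

2^≤n≤2^suc : ∀ n → 0 < n → Σ ℕ λ e → 2 ^ e ≤ n × n ≤ 2 ^ suc e
2^≤n≤2^suc (suc zero)    _ = 0 , ≤-refl , s≤s z≤n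
2^≤n≤2^suc (suc (suc n)) _ with 2^≤n≤2^suc (suc n) (s≤s z≤n)
... | e , lower , upper with suc (suc n) ≤? 2 ^ suc e
...   | yes upper′ = e , m≤n⇒m≤1+n lower , upper′
...   | no  n≰     = suc e , <⇒≤ (≰⇒> n≰) , (begin
  suc (suc n)           ≤⟨ s≤s upper ⟩
  suc (2 ^ suc e)       ≤⟨ +-monoˡ-≤ (2 ^ suc e) (m^n>0 2 (suc e)) ⟩
  2 ^ suc e + 2 ^ suc e ≡⟨ sym (2^suc≡2^+2^ (suc e)) ⟩
  2 ^ suc (suc e)       ∎)
  where open ≤-Reasoning

lemma4p6 : (f₂ g₂ : ℕ → ℕ) → StrictlyIncreasing f₂ → StrictlyIncreasing g₂
    → (∀ i → g₂ i < f₂ i) → Summable (λ i → frac (g₂ i) (f₂ i))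
    → (Λ : Set)
    → ((Y : Λ → (i : ℕ) → Fin (f₂ i))
        → Σ ((i : ℕ) → Subset (f₂ i)) λ ν
            → (∀ i → ν i ∈[ f₂ i ]^ g₂ i)
            × (∀ a → InfinitelyMany (λ i → Y a i ∈ ν i)))
    → (Z : Λ → Cantor)
    → Null (λ x → Σ Λ λ a → ∀ n → Z a n ≡ x n)
lemma4p6 f₂ g₂ _ _ g<f summable Λ hyp Z = Null-mono covered (Null-blockwise L ν summable′)
  where
  f>0 : ∀ i → 0 < f₂ i
  f>0 i = ≤-trans (s≤s z≤n) (g<f i)

  bracket : ∀ i → Σ ℕ λ e → 2 ^ e ≤ f₂ i × f₂ i ≤ 2 ^ suc e
  bracket i = 2^≤n≤2^suc (f₂ i) (f>0 i)

  L : ℕ → ℕ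
  L = proj₁ ∘ bracket

  open Blocks L

  code : Λ → (i : ℕ) → Fin (f₂ i)
  code a i = fromℕ< (≤-trans (block<2^ (Z a) i) (proj₁ (proj₂ (bracket i))))

  ν : (i : ℕ) → Subset (f₂ i)
  ν = proj₁ (hyp code)

  summable′ : Summable (λ i → frac ∣ ν i ∣ (2 ^ L i))
  summable′ = Summable-≤-double (λ i →
    subst (λ c → frac c (2 ^ L i) ≤ℚ _) (sym (proj₁ (proj₂ (hyp code)) i))
          (frac-≤-double (g₂ i) (m^n>0 2 (L i)) (f>0 i) (proj₂ (proj₂ (bracket i))))) summable

  covered : ∀ x → (Σ Λ λ a → ∀ n → Z a n ≡ x n) →
            InfinitelyMany (λ i → indicator (ν i) (block x i) ≡ 1)
  covered x (a , Za≡x) N with proj₂ (proj₂ (hyp code)) a N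
  ... | i , N≤i , code∈ν = i , N≤i , trans (cong (indicator (ν i)) block≡code) (indicator-∈ code∈ν)
    where
    block≡code : block x i ≡ toℕ (code a i)
    block≡code = trans (value-cong (L i) (λ q _ → sym (Za≡x (blockStart i + q)))) (sym (toℕ-fromℕ< _))
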